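{- Let $(D,Q)$ be a discriminant form of prime power level, with $\mathrm{sign}(D)=0$ and $|D|$ a square, which possesses at least one self-dual isotropic subgroup. Then every isotropic subgroup $H\subseteq D$ is contained in some self-dual isotropic subgroup. Moreover, the maximal elements (with respect to inclusion) of the set of isotropic subgroups of $D$ are exactly the self-dual isotropic subgroups.
   Context: A discriminant form is a finite abelian group $D$ with non-degenerate quadratic form $Q\colon D\to\mathbb{Q}/\mathbb{Z}$ and bilinear form $(\beta,\gamma)=Q(\beta+\gamma)-Q(\beta)-Q(\gamma)$; level and signature as usual ($\mathbf{e}(\mathrm{sign}(D)/8)=|D|^{ -1/2}\sum_\gamma e^{2\pi i Q(\gamma)}$). For a subgroup $H$, $H^\perp=\{\gamma:(\gamma,H)=0\}$; $H$ is self-dual if $H=H^\perp$ and isotropic if $H\subseteq H^\perp$ and $Q|_H=0$. -}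

module Defs where

open import Data.Nat as ℕ using (ℕ; zero; suc; NonZero)
open import Data.Nat.Primality using (Prime)
open import Data.Integer as ℤ using (ℤ; +_)
open import Data.Integer.DivMod using (_%ℕ_)
open import Data.Rational as ℚ using (ℚ; floor)
open import Data.Fin using (Fin)
open import Data.Bool using (Bool; true; false; if_then_else_)
open import Data.List using (List; []; _∷_; map; sum; upTo; allFin; foldr)
open import Data.Product using (Σ; ∃; ∃-syntax; _×_; _,_)
open import Relation.Binary.PropositionalEquality using (_≡_)
open import Algebra.Structures using (IsAbelianGroup)
open import Function.Bundles using (_↔_; Inverse)

-- ℚ/ℤ : rationals are used as representatives; x ≈ y in ℚ/ℤ iff x - y ∈ ℤ

ℤtoℚ : ℤ → ℚ
ℤtoℚ z = z ℚ./ 1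

IsInt : ℚ → Set
IsInt q = ∃[ z ] q ≡ ℤtoℚ z

_≡ℚ/ℤ_ : ℚ → ℚ → Set
x ≡ℚ/ℤ y = IsInt (x ℚ.- y)

record FinAbGroup : Set₁ where
  field
    Carrier : Set
    _+_     : Carrier → Carrier → Carrier
    0#      : Carrier
    -_      : Carrier → Carrier
    isAbelianGroup : IsAbelianGroup _≡_ _+_ 0# -_
    size    : ℕ
    enum    : Fin size ↔ Carrier

  _·ℕ_ : ℕ → Carrier → Carrier
  zero  ·ℕ g = 0#
  suc n ·ℕ g = g + (n ·ℕ g)

  _·_ : ℤ → Carrier → Carrier
  (+ n)      · g = n ·ℕ g
  ℤ.-[1+ n ] · g = - (suc n ·ℕ g)

  elements : List Carrier
  elements = map (Inverse.to enum) (allFin size)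

record DiscriminantForm : Set₁ where
  field
    group : FinAbGroup
  open FinAbGroup group public
  field
    Q : Carrier → ℚ
    Q-hom : ∀ (a : ℤ) γ → Q (a · γ) ≡ℚ/ℤ (ℤtoℚ (a ℤ.* a) ℚ.* Q γ)

  B : Carrier → Carrier → ℚ
  B β γ = Q (β + γ) ℚ.- Q β ℚ.- Q γ

  field
    B-bilinear : ∀ β β' γ → B (β + β') γ ≡ℚ/ℤ (B β γ ℚ.+ B β' γ)
    nondegenerate : ∀ β → (∀ γ → IsInt (B β γ)) → β ≡ 0#

open DiscriminantForm public

IsLevel : DiscriminantForm → ℕ → Set
IsLevel D N = NonZero N
            × (∀ γ → IsInt (ℤtoℚ (+ N) ℚ.* Q D γ))
            × (∀ M → NonZero M → (∀ γ → IsInt (ℤtoℚ (+ M) ℚ.* Q D γ)) → N ℕ.≤ M)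

HasPrimePowerLevel : DiscriminantForm → ℕ → ℕ → Set
HasPrimePowerLevel D p k = Prime p × IsLevel D (p ℕ.^ k)

-- Polynomials over ℤ (coefficient lists, lowest degree first), used to
-- model the cyclotomic ring ℤ[ζ_M] = ℤ[x]/(Φ_M) ⊂ ℂ.

coeff : List ℤ → ℕ → ℤ
coeff []       _       = + 0
coeff (a ∷ _)  zero    = a
coeff (_ ∷ as) (suc i) = coeff as i

convCoeff : List ℤ → (ℕ → ℤ) → ℕ → ℤ
convCoeff q f i = foldr ℤ._+_ (+ 0) (map (λ t → coeff q t ℤ.* f (i ℕ.∸ t)) (upTo (suc i)))

-- Cyclotomic polynomial Φ_{p^(k+1)}(x) = Σ_{j<p} x^{j p^k}, as coefficient function
cyclotomicPP : (p k : ℕ) → ℕ → ℤ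
cyclotomicPP p k i =
  foldr ℤ._+_ (+ 0) (map (λ j → if (j ℕ.* p ℕ.^ k) ℕ.≡ᵇ i then + 1 else + 0) (upTo p))

CongModCyclo : (p k : ℕ) → (ℕ → ℤ) → (ℕ → ℤ) → Set
CongModCyclo p k f g = ∃[ q ] (∀ i → f i ℤ.- g i ≡ convCoeff q (cyclotomicPP p k) i)

-- Gauss sum  Σ_γ e(Q(γ))  as an element of ℤ[ζ_M], M = p^(k+1).
-- e(Q(γ)) = ζ_M^{a} where a = M·Q(γ) mod M (an integer when the level divides M).

expo : (D : DiscriminantForm) (M : ℕ) .{{_ : NonZero M}} → Carrier D → ℕ
expo D M γ = floor (ℤtoℚ (+ M) ℚ.* Q D γ) %ℕ M

gaussCoeff : (D : DiscriminantForm) (M : ℕ) .{{_ : NonZero M}} → ℕ → ℤ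
gaussCoeff D M i =
  foldr ℤ._+_ (+ 0) (map (λ γ → if expo D M γ ℕ.≡ᵇ i then + 1 else + 0) (elements D))

constPoly : ℕ → ℕ → ℤ
constPoly m zero    = + m
constPoly m (suc _) = + 0

-- sign(D) = 0, i.e. Σ_γ e(Q(γ)) = |D|^{1/2}, stated when |D| = m²
-- (so that |D|^{1/2} = m), with level dividing p^(k+1).
-- (the NonZero argument is a proof-irrelevant side condition; p is prime)
SignZero : (D : DiscriminantForm) (p k m : ℕ) → Set
SignZero D p k m = ∀ {{_ : NonZero (p ℕ.^ suc k)}} → CongModCyclo p k (gaussCoeff D (p ℕ.^ suc k)) (constPoly m)

_∈_ : {A : Set} → A → (A → Bool) → Set
γ ∈ H = H γ ≡ true

IsSubgroup : (D : DiscriminantForm) → (Carrier D → Bool) → Set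
IsSubgroup D H = (0# D ∈ H)
               × (∀ β γ → β ∈ H → γ ∈ H → _+_ D β γ ∈ H)
               × (∀ γ → γ ∈ H → -_ D γ ∈ H)

_⊆_ : {A : Set} → (A → Bool) → (A → Bool) → Set
H ⊆ K = ∀ γ → γ ∈ H → γ ∈ K

InPerp : (D : DiscriminantForm) → (Carrier D → Bool) → Carrier D → Set
InPerp D H γ = ∀ β → β ∈ H → IsInt (B D γ β)

IsSelfDual : (D : DiscriminantForm) → (Carrier D → Bool) → Set
IsSelfDual D H = ∀ γ → (γ ∈ H → InPerp D H γ) × (InPerp D H γ → γ ∈ H)

IsIsotropic : (D : DiscriminantForm) → (Carrier D → Bool) → Set
IsIsotropic D H = IsSubgroup D H
                × (∀ γ → γ ∈ H → InPerp D H γ)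
                × (∀ γ → γ ∈ H → IsInt (Q D γ))

IsSelfDualIsotropic : (D : DiscriminantForm) → (Carrier D → Bool) → Set
IsSelfDualIsotropic D H = IsSelfDual D H × IsIsotropic D H

IsMaximalIsotropic : (D : DiscriminantForm) → (Carrier D → Bool) → Set
IsMaximalIsotropic D H = IsIsotropic D H × (∀ K → IsIsotropic D K → H ⊆ K → K ⊆ H)

module Submission where

-- The engine is Yᗮᗮ = Y for every subgroup Y of D, a consequence of |Y| |Yᗮ| = |D|. To count,
-- grow a subgroup Z₀ one element at a time: if y has order n modulo Z₀ and Z₁ = Z₀ + ⟨y⟩, then
-- |Z₁| ≥ n |Z₀| (the cosets z + j y, j < n, are disjoint), while W ∩ Z₀ᗮ splits into at most n
-- classes according to the value of B(y, ·) in (1/n)ℤ/ℤ, and differences within one class lie in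
-- W ∩ Z₁ᗮ. Hence |Z| |W ∩ Zᗮ| does not decrease along a chain of subgroups. The chain 0 ⊆ Y with
-- W = D gives |D| ≤ |Y| |Yᗮ|; the chain Yᗮ ⊆ D with W = Y, together with Dᗮ = 0, gives
-- |Yᗮ| |Y| ≤ |D|.
--
-- For a self-dual isotropic S and an isotropic H, T = (S ∩ Hᗮ) + H is isotropic and contains H.
-- If x ⊥ T then x ∈ Hᗮ and x ⊥ (S + H)ᗮ ⊆ T, so x ∈ (S + H)ᗮᗮ ∩ Hᗮ = (S + H) ∩ Hᗮ = T. A maximal
-- isotropic H equals its extension T, hence is self-dual; a self-dual H is maximal since any
-- isotropic K ⊇ H satisfies K ⊆ Kᗮ ⊆ Hᗮ = H. The level only serves to bound the orders of elements.

open import Defs using (ℤtoℚ; IsInt; _≡ℚ/ℤ_; DiscriminantForm; module DiscriminantForm; IsSubgroup; InPerp;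
                        IsSelfDual; IsIsotropic; IsSelfDualIsotropic; IsMaximalIsotropic; IsLevel;
                        HasPrimePowerLevel; SignZero)
open import Level using (0ℓ)
open import Algebra.Bundles using (AbelianGroup)
open import Algebra.Structures using (module IsAbelianGroup)
open import Data.Nat as ℕ using (ℕ; zero; suc; _≤_; _<_; z≤n; s≤s; _<ᵇ_; _≡ᵇ_)
import Data.Nat.Properties as ℕP
open import Data.Nat.Properties using (anyUpTo?)
open import Data.Nat.DivMod using (_%_; _/_; m≡m%n+[m/n]*n; m%n<n)
import Data.Integer as ℤ
import Data.Rational as ℚ
import Data.Rational.Properties as ℚP
open import Data.Rational.Solver using (module +-*-Solver)
open +-*-Solver using (solve; _:+_; _:-_; :-_; _:*_; _:=_)
open import Data.Bool using (Bool; true; false; _∧_; not; if_then_else_)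
import Data.Bool.Properties as BoolP
open import Data.List using (List; []; _∷_; length; map; filter; allFin)
open import Data.List.Properties using (length-map; length-removeAt′)
open import Data.List.Membership.Propositional renaming (_∈_ to _∈ₗ_)
open import Data.List.Membership.Propositional.Properties using (∈-filter⁺; ∈-filter⁻; ∈-map⁺; ∈-map⁻; ∈-allFin)
open import Data.List.Relation.Unary.All as All using (All)
open import Data.List.Relation.Unary.AllPairs using ([]; _∷_)
import Data.List.Relation.Unary.Any as Any
open import Data.List.Relation.Unary.Any using (here; there; index)
open import Data.List.Relation.Unary.Unique.Propositional using (Unique)
import Data.List.Relation.Unary.Unique.Propositional.Properties as UniqueP
open import Data.Fin.Properties using (inj⇒≟)
open import Data.Product using (∃; ∃-syntax; _×_; _,_; proj₁; proj₂)
open import Function using (id; _∘_)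
open import Function.Bundles using (Equivalence; Injection; Inverse)
open import Function.Properties.Inverse using (↔⇒↣; ↔-sym)
open import Relation.Binary.Definitions using (DecidableEquality)
open import Relation.Binary.PropositionalEquality
open import Relation.Nullary using (Dec; yes; no; ¬_; ¬?; does; contradiction)
open import Relation.Nullary.Decidable using (dec-true; map′; _→-dec_; _×-dec_)
open import Relation.Unary using (Decidable)

module ℚ/ℤ where

  open ℤ using (ℤ; +_; -[1+_])
  open ℚ using (ℚ; mkℚ; _+_; _*_; _-_; -_)
  import Data.Integer.Properties as ℤP
  open import Data.Integer.DivMod using (_%ℕ_; _/ℕ_; a≡a%ℕn+[a/ℕn]*n; n%ℕd<d)
  open import Data.Integer.Tactic.RingSolver using (solve-∀)
  open import Data.Nat.Coprimality using (1-coprimeTo) renaming (sym to coprime-sym)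

  -- For a variable z, ℤtoℚ z = z / 1 is stuck on a gcd; rewriting with this lemma exposes the
  -- literal normal form, on which the ℚ operations compute.
  ℤtoℚ-mkℚ : ∀ z → ℤtoℚ z ≡ mkℚ z 0 (coprime-sym (1-coprimeTo _))
  ℤtoℚ-mkℚ z = ℚP.↥p/↧p≡p (mkℚ z 0 (coprime-sym (1-coprimeTo _)))

  ℤtoℚ-+ : ∀ a b → ℤtoℚ (a ℤ.+ b) ≡ ℤtoℚ a + ℤtoℚ b
  ℤtoℚ-+ a b rewrite ℤtoℚ-mkℚ a | ℤtoℚ-mkℚ b
                   | ℤP.*-identityʳ a | ℤP.*-identityʳ b = refl

  ℤtoℚ-* : ∀ a b → ℤtoℚ (a ℤ.* b) ≡ ℤtoℚ a * ℤtoℚ b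
  ℤtoℚ-* a b rewrite ℤtoℚ-mkℚ a | ℤtoℚ-mkℚ b = refl

  ℤtoℚ-neg : ∀ a → ℤtoℚ (ℤ.- a) ≡ - ℤtoℚ a
  ℤtoℚ-neg a rewrite ℤtoℚ-mkℚ a | ℤtoℚ-mkℚ (ℤ.- a) = neg-mkℚ a
    where
    neg-mkℚ : ∀ a → mkℚ (ℤ.- a) 0 (coprime-sym (1-coprimeTo _)) ≡ - mkℚ a 0 (coprime-sym (1-coprimeTo _))
    neg-mkℚ (+ zero)  = refl
    neg-mkℚ (+ suc n) = refl
    neg-mkℚ -[1+ n ]  = refl

  ℤtoℚ-diff : ∀ a b → ℤtoℚ (a ℤ.- b) ≡ ℤtoℚ a - ℤtoℚ b
  ℤtoℚ-diff a b = trans (ℤtoℚ-+ a (ℤ.- b)) (cong (λ w → ℤtoℚ a + w) (ℤtoℚ-neg b))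

  numerator-ℤtoℚ : ∀ z → ℚ.numerator (ℤtoℚ z) ≡ z
  numerator-ℤtoℚ z rewrite ℤtoℚ-mkℚ z = refl

  IsInt-ℤ : ∀ z → IsInt (ℤtoℚ z)
  IsInt-ℤ z = z , refl

  IsInt-resp : ∀ {x y} → x ≡ y → IsInt x → IsInt y
  IsInt-resp = subst IsInt

  IsInt-+ : ∀ {x y} → IsInt x → IsInt y → IsInt (x + y)
  IsInt-+ (a , refl) (b , refl) = a ℤ.+ b , sym (ℤtoℚ-+ a b)

  IsInt-neg : ∀ {x} → IsInt x → IsInt (- x)
  IsInt-neg (a , refl) = ℤ.- a , sym (ℤtoℚ-neg a)

  IsInt-* : ∀ {x y} → IsInt x → IsInt y → IsInt (x * y)
  IsInt-* (a , refl) (b , refl) = a ℤ.* b , sym (ℤtoℚ-* a b)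

  IsInt-diff : ∀ {x y} → IsInt x → IsInt y → IsInt (x - y)
  IsInt-diff i j = IsInt-+ i (IsInt-neg j)

  ≡ℚ/ℤ-sym : ∀ {x y} → x ≡ℚ/ℤ y → y ≡ℚ/ℤ x
  ≡ℚ/ℤ-sym {x} {y} = IsInt-resp (solve 2 (λ x y → :- (x :- y) := y :- x) refl x y) ∘ IsInt-neg

  ≡ℚ/ℤ-trans : ∀ {x y z} → x ≡ℚ/ℤ y → y ≡ℚ/ℤ z → x ≡ℚ/ℤ z
  ≡ℚ/ℤ-trans {x} {y} {z} i j =
    IsInt-resp (solve 3 (λ x y z → (x :- y) :+ (y :- z) := x :- z) refl x y z) (IsInt-+ i j)

  ≡ℚ/ℤ-+ˡ : ∀ x {y y'} → y ≡ℚ/ℤ y' → (x + y) ≡ℚ/ℤ (x + y')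
  ≡ℚ/ℤ-+ˡ x {y} {y'} = IsInt-resp (solve 3 (λ x y y' → y :- y' := (x :+ y) :- (x :+ y')) refl x y y')

  ≡ℚ/ℤ-IsInt : ∀ {x y} → x ≡ℚ/ℤ y → IsInt y → IsInt x
  ≡ℚ/ℤ-IsInt {x} {y} i j = IsInt-resp (solve 2 (λ x y → (x :- y) :+ y := x) refl x y) (IsInt-+ i j)

  *-cancelˡ-suc : ∀ k {r s} → ℤtoℚ (+ suc k) * r ≡ ℤtoℚ (+ suc k) * s → r ≡ s
  *-cancelˡ-suc k {r} {s} e rewrite ℤtoℚ-mkℚ (+ suc k) = begin
    r                    ≡⟨ sym (ℚP.*-identityˡ r) ⟩
    ℚ.1ℚ * r             ≡⟨ cong (_* r) (sym (ℚP.*-inverseˡ n)) ⟩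
    ℚ.1/ n * n * r       ≡⟨ ℚP.*-assoc (ℚ.1/ n) n r ⟩
    ℚ.1/ n * (n * r)     ≡⟨ cong (ℚ.1/ n *_) e ⟩
    ℚ.1/ n * (n * s)     ≡⟨ sym (ℚP.*-assoc (ℚ.1/ n) n s) ⟩
    ℚ.1/ n * n * s       ≡⟨ cong (_* s) (ℚP.*-inverseˡ n) ⟩
    ℚ.1ℚ * s             ≡⟨ ℚP.*-identityˡ s ⟩
    s                    ∎
    where
    open ≡-Reasoning
    n = mkℚ (+ suc k) 0 (coprime-sym (1-coprimeTo _))

  residue : (n : ℕ) .{{_ : ℕ.NonZero n}} → ℚ → ℕ
  residue n q = ℚ.numerator q %ℕ n

  residue<n : ∀ n .{{_ : ℕ.NonZero n}} q → residue n q ℕ.< n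
  residue<n n q = n%ℕd<d (ℚ.numerator q) n

  same-%ℕ⇒diff≡* : ∀ d .{{_ : ℕ.NonZero d}} {z z'} → z %ℕ d ≡ z' %ℕ d → z ℤ.- z' ≡ + d ℤ.* (z /ℕ d ℤ.- z' /ℕ d)
  same-%ℕ⇒diff≡* d {z} {z'} same = begin
    z ℤ.- z'
      ≡⟨ cong₂ ℤ._-_ (a≡a%ℕn+[a/ℕn]*n z d) (a≡a%ℕn+[a/ℕn]*n z' d) ⟩
    (+ (z %ℕ d) ℤ.+ q ℤ.* + d) ℤ.- (+ r' ℤ.+ q' ℤ.* + d)
      ≡⟨ cong (λ r → (+ r ℤ.+ q ℤ.* + d) ℤ.- (+ r' ℤ.+ q' ℤ.* + d)) same ⟩
    (+ r' ℤ.+ q ℤ.* + d) ℤ.- (+ r' ℤ.+ q' ℤ.* + d) ≡⟨ remainders-cancel (+ r') q q' (+ d) ⟩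
    + d ℤ.* (q ℤ.- q')                             ∎
    where
    open ≡-Reasoning
    q = z /ℕ d
    q' = z' /ℕ d
    r' = z' %ℕ d
    remainders-cancel : ∀ r a b n → (r ℤ.+ a ℤ.* n) ℤ.- (r ℤ.+ b ℤ.* n) ≡ n ℤ.* (a ℤ.- b)
    remainders-cancel = solve-∀

  same-residue⇒≡ℚ/ℤ : ∀ k {q q'} → IsInt (ℤtoℚ (+ suc k) * q) → IsInt (ℤtoℚ (+ suc k) * q')
                     → residue (suc k) (ℤtoℚ (+ suc k) * q) ≡ residue (suc k) (ℤtoℚ (+ suc k) * q')
                     → q ≡ℚ/ℤ q'
  same-residue⇒≡ℚ/ℤ k {q} {q'} (z , e) (z' , e') r = t , *-cancelˡ-suc k (begin
    n * (q - q')               ≡⟨ solve 3 (λ n q q' → n :* (q :- q') := n :* q :- n :* q') refl n q q' ⟩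
    n * q - n * q'             ≡⟨ cong₂ _-_ e e' ⟩
    ℤtoℚ z - ℤtoℚ z'           ≡⟨ sym (ℤtoℚ-diff z z') ⟩
    ℤtoℚ (z ℤ.- z')             ≡⟨ cong ℤtoℚ (same-%ℕ⇒diff≡* (suc k) {z} {z'} z≡z') ⟩
    ℤtoℚ (+ suc k ℤ.* t)       ≡⟨ ℤtoℚ-* (+ suc k) t ⟩
    n * ℤtoℚ t                 ∎)
    where
    open ≡-Reasoning
    n = ℤtoℚ (+ suc k)
    t = z /ℕ suc k ℤ.- z' /ℕ suc k
    z≡z' : z %ℕ suc k ≡ z' %ℕ suc k
    z≡z' = subst₂ (λ a b → a %ℕ suc k ≡ b %ℕ suc k)
             (trans (cong ℚ.numerator e) (numerator-ℤtoℚ z))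
             (trans (cong ℚ.numerator e') (numerator-ℤtoℚ z')) r

  isInt? : Decidable IsInt
  isInt? (mkℚ n zero _)    = yes (n , sym (ℤtoℚ-mkℚ n))
  isInt? (mkℚ n (suc d) _) = no λ (z , e) → ℕP.1+n≢0 (cong ℚ.denominator-1 (trans e (ℤtoℚ-mkℚ z)))

open ℚ/ℤ

-- Finite enumerations and counting

module _ {A : Set} where

  ∈-─ : ∀ {x y : A} {ys} (p : x ∈ₗ ys) → y ∈ₗ ys → y ≢ x → y ∈ₗ (ys ─ p)
  ∈-─ (here refl) (here refl) y≢x = contradiction refl y≢x
  ∈-─ (here refl) (there q)   _   = q
  ∈-─ (there p)   (here refl) _   = here refl
  ∈-─ (there p)   (there q)   y≢x = there (∈-─ p q y≢x)

  Unique⇒length≤ : ∀ {xs ys : List A} → Unique xs → (∀ {x} → x ∈ₗ xs → x ∈ₗ ys) → length xs ≤ length ys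
  Unique⇒length≤ {[]}     _             _   = z≤n
  Unique⇒length≤ {x ∷ xs} {ys} (x∉xs ∷ u) xs⊆ys =
    subst (suc (length xs) ≤_) (sym (length-removeAt′ ys (index x∈ys)))
      (s≤s (Unique⇒length≤ u λ z∈xs → ∈-─ x∈ys (xs⊆ys (there z∈xs)) (≢-sym (All.lookup x∉xs z∈xs))))
    where x∈ys = xs⊆ys (here refl)

-- Defs._∈_ and Defs._⊆_, with fixities.
infix 4 _∈_ _⊆_
_∈_ : {A : Set} → A → (A → Bool) → Set
a ∈ P = P a ≡ true

_⊆_ : {A : Set} → (A → Bool) → (A → Bool) → Set
P ⊆ Q = ∀ a → a ∈ P → a ∈ Q

module _ {A : Set} where

  infixr 7 _∩_
  _∩_ : (A → Bool) → (A → Bool) → A → Bool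
  (P ∩ Q) a = P a ∧ Q a

  ∁ : (A → Bool) → A → Bool
  ∁ P a = not (P a)

  ∈-∩⁺ : ∀ P Q {a} → a ∈ P → a ∈ Q → a ∈ P ∩ Q
  ∈-∩⁺ _ _ a∈P a∈Q rewrite a∈P | a∈Q = refl

  ∈-∩⁻ : ∀ P Q {a} → a ∈ P ∩ Q → a ∈ P × a ∈ Q
  ∈-∩⁻ P _ {a} e with P a
  ... | true = refl , e

  infix 4 _∈?_
  _∈?_ : ∀ (a : A) P → Dec (a ∈ P)
  a ∈? P = P a BoolP.≟ true

  ⌊_⌋ : {P : A → Set} → Decidable P → A → Bool
  ⌊ P? ⌋ a = does (P? a)

  ∈⌊⌋⁺ : ∀ {P : A → Set} (P? : Decidable P) {a} → P a → a ∈ ⌊ P? ⌋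
  ∈⌊⌋⁺ P? {a} = dec-true (P? a)

  ∈⌊⌋⁻ : ∀ {P : A → Set} (P? : Decidable P) {a} → a ∈ ⌊ P? ⌋ → P a
  ∈⌊⌋⁻ P? {a} a∈ with P? a
  ... | yes Pa = Pa

module FiniteEnumeration {A : Set} (elems : List A) (elems-unique : Unique elems) (elems-complete : ∀ x → x ∈ₗ elems) where

  ∀? : {P : A → Set} → Decidable P → Dec (∀ x → P x)
  ∀? P? = map′ (λ all x → All.lookup all (elems-complete x)) (λ ∀P → All.tabulate λ {x} _ → ∀P x)
               (All.all? P? elems)

  ∃? : {P : A → Set} → Decidable P → Dec (∃ P)
  ∃? P? = map′ Any.satisfied (λ (x , Px) → Any.map (λ { refl → Px }) (elems-complete x))
               (Any.any? P? elems)

  private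
    select : (A → Bool) → List A → List A
    select P = filter (_∈? P)

  count : (A → Bool) → ℕ
  count P = length (select P elems)

  private
    select∈⁺ : ∀ {P a} → a ∈ P → a ∈ₗ select P elems
    select∈⁺ {P} {a} = ∈-filter⁺ (_∈? P) (elems-complete a)

    select∈⁻ : ∀ {P a} → a ∈ₗ select P elems → a ∈ P
    select∈⁻ {P} = proj₂ ∘ ∈-filter⁻ (_∈? P) {xs = elems}

    select-unique : ∀ P → Unique (select P elems)
    select-unique P = UniqueP.filter⁺ (_∈? P) elems-unique

  count-≤-length : ∀ {P} {ys} → (∀ a → a ∈ P → a ∈ₗ ys) → count P ≤ length ys
  count-≤-length {P} P⊆ys = Unique⇒length≤ (select-unique P) (P⊆ys _ ∘ select∈⁻)

  count-inj : ∀ {P Q} (f : A → A) → (∀ {a b} → f a ≡ f b → a ≡ b) → (∀ a → a ∈ P → f a ∈ Q)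
            → count P ≤ count Q
  count-inj {P} {Q} f f-inj f[P]⊆Q = subst (_≤ count Q) (length-map f (select P elems))
    (Unique⇒length≤ (UniqueP.map⁺ f-inj (select-unique P)) image⊆)
    where
    image⊆ : ∀ {b} → b ∈ₗ map f (select P elems) → b ∈ₗ select Q elems
    image⊆ b∈ with a , a∈ , refl ← ∈-map⁻ f b∈ = select∈⁺ (f[P]⊆Q a (select∈⁻ a∈))

  count-mono : ∀ {P Q} → P ⊆ Q → count P ≤ count Q
  count-mono = count-inj id id

  count-mono-< : ∀ {P Q a} → P ⊆ Q → a ∈ Q → ¬ a ∈ P → count P < count Q
  count-mono-< {P} {Q} {a} P⊆Q a∈Q a∉P = Unique⇒length≤ (a∉select ∷ select-unique P) ⊆select
    where
    a∉select : All (a ≢_) (select P elems)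
    a∉select = All.tabulate λ b∈ a≡b → a∉P (subst (_∈ P) (sym a≡b) (select∈⁻ b∈))
    ⊆select : ∀ {b} → b ∈ₗ a ∷ select P elems → b ∈ₗ select Q elems
    ⊆select (here refl) = select∈⁺ a∈Q
    ⊆select (there b∈)  = select∈⁺ (P⊆Q _ (select∈⁻ b∈))

  count-pos : ∀ {P a} → a ∈ P → 1 ≤ count P
  count-pos a∈P = Unique⇒length≤ (All.[] ∷ []) λ { (here refl) → select∈⁺ a∈P }

  count-cong : ∀ {P Q} → (∀ a → P a ≡ Q a) → count P ≡ count Q
  count-cong P≗Q = ℕP.≤-antisym (count-mono λ a e → trans (sym (P≗Q a)) e)
                                (count-mono λ a e → trans (P≗Q a) e)

  private
    length-select-split : ∀ P S xs → length (select P xs)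
                        ≡ length (select (P ∩ S) xs) ℕ.+ length (select (P ∩ ∁ S) xs)
    length-select-split P S []       = refl
    length-select-split P S (x ∷ xs) with P x | S x
    ... | true  | true  = cong suc (length-select-split P S xs)
    ... | true  | false = trans (cong suc (length-select-split P S xs)) (sym (ℕP.+-suc _ _))
    ... | false | _     = length-select-split P S xs

  count-split : ∀ P S → count P ≡ count (P ∩ S) ℕ.+ count (P ∩ ∁ S)
  count-split P S = length-select-split P S elems

  fibre : (A → ℕ) → ℕ → A → Bool
  fibre f j a = f a ≡ᵇ j

  ∈-fibre⁺ : ∀ {f : A → ℕ} {j a} → f a ≡ j → a ∈ fibre f j
  ∈-fibre⁺ {f} {j} {a} fa≡j = Equivalence.to BoolP.T-≡ (ℕP.≡⇒≡ᵇ (f a) j fa≡j)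

  ∈-fibre⁻ : ∀ {f : A → ℕ} {j a} → a ∈ fibre f j → f a ≡ j
  ∈-fibre⁻ {f} {j} {a} a∈ = ℕP.≡ᵇ⇒≡ (f a) j (Equivalence.from BoolP.T-≡ a∈)

  private
    below : (A → ℕ) → ℕ → A → Bool
    below f n a = f a <ᵇ n

    <ᵇ-suc-∧-≡ᵇ : ∀ m n → (m <ᵇ suc n) ∧ (m ≡ᵇ n) ≡ (m ≡ᵇ n)
    <ᵇ-suc-∧-≡ᵇ zero    zero    = refl
    <ᵇ-suc-∧-≡ᵇ zero    (suc n) = refl
    <ᵇ-suc-∧-≡ᵇ (suc m) zero    = refl
    <ᵇ-suc-∧-≡ᵇ (suc m) (suc n) = <ᵇ-suc-∧-≡ᵇ m n

    <ᵇ-suc-∧-≢ᵇ : ∀ m n → (m <ᵇ suc n) ∧ not (m ≡ᵇ n) ≡ (m <ᵇ n)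
    <ᵇ-suc-∧-≢ᵇ zero    zero    = refl
    <ᵇ-suc-∧-≢ᵇ zero    (suc n) = refl
    <ᵇ-suc-∧-≢ᵇ (suc m) zero    = refl
    <ᵇ-suc-∧-≢ᵇ (suc m) (suc n) = <ᵇ-suc-∧-≢ᵇ m n

    count-below-suc : ∀ P f n → count (P ∩ below f (suc n)) ≡ count (P ∩ below f n) ℕ.+ count (P ∩ fibre f n)
    count-below-suc P f n = begin
      count (P ∩ below f (suc n))
        ≡⟨ count-split (P ∩ below f (suc n)) (fibre f n) ⟩
      count ((P ∩ below f (suc n)) ∩ fibre f n) ℕ.+ count ((P ∩ below f (suc n)) ∩ ∁ (fibre f n))
        ≡⟨ cong₂ ℕ._+_ (count-cong λ a → trans (BoolP.∧-assoc (P a) _ _) (cong (P a ∧_) (<ᵇ-suc-∧-≡ᵇ (f a) n)))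
                       (count-cong λ a → trans (BoolP.∧-assoc (P a) _ _) (cong (P a ∧_) (<ᵇ-suc-∧-≢ᵇ (f a) n))) ⟩
      count (P ∩ fibre f n) ℕ.+ count (P ∩ below f n)
        ≡⟨ ℕP.+-comm (count (P ∩ fibre f n)) _ ⟩
      count (P ∩ below f n) ℕ.+ count (P ∩ fibre f n) ∎
      where open ≡-Reasoning

    count-below-≤ : ∀ P f n c → (∀ j → j < n → count (P ∩ fibre f j) ≤ c) → count (P ∩ below f n) ≤ n ℕ.* c
    count-below-≤ P f zero    c _ = count-≤-length {ys = []} λ a e → contradiction
      (trans (sym e) (trans (cong (P a ∧_) (<ᵇ-zero (f a))) (BoolP.∧-zeroʳ (P a)))) λ ()
      where
      <ᵇ-zero : ∀ m → (m <ᵇ 0) ≡ false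
      <ᵇ-zero zero    = refl
      <ᵇ-zero (suc m) = refl
    count-below-≤ P f (suc n) c fibres≤c = begin
      count (P ∩ below f (suc n))                     ≡⟨ count-below-suc P f n ⟩
      count (P ∩ below f n) ℕ.+ count (P ∩ fibre f n) ≤⟨ ℕP.+-mono-≤ (count-below-≤ P f n c λ j → fibres≤c j ∘ ℕP.m<n⇒m<1+n)
                                                                      (fibres≤c n ℕP.≤-refl) ⟩
      n ℕ.* c ℕ.+ c                                   ≡⟨ ℕP.+-comm (n ℕ.* c) c ⟩
      suc n ℕ.* c                                     ∎
      where open ℕP.≤-Reasoning

    count-below-≥ : ∀ P f n c → (∀ j → j < n → c ≤ count (P ∩ fibre f j)) → n ℕ.* c ≤ count (P ∩ below f n)
    count-below-≥ P f zero    c _ = z≤n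
    count-below-≥ P f (suc n) c c≤fibres = begin
      suc n ℕ.* c                                     ≡⟨ ℕP.+-comm c (n ℕ.* c) ⟩
      n ℕ.* c ℕ.+ c                                   ≤⟨ ℕP.+-mono-≤ (count-below-≥ P f n c λ j → c≤fibres j ∘ ℕP.m<n⇒m<1+n)
                                                                      (c≤fibres n ℕP.≤-refl) ⟩
      count (P ∩ below f n) ℕ.+ count (P ∩ fibre f n) ≡⟨ count-below-suc P f n ⟨
      count (P ∩ below f (suc n))                     ∎
      where open ℕP.≤-Reasoning

  count-≤-fibres : ∀ P (f : A → ℕ) n c → (∀ a → a ∈ P → f a < n)
                 → (∀ j → j < n → count (P ∩ fibre f j) ≤ c) → count P ≤ n ℕ.* c
  count-≤-fibres P f n c f<n fibres≤c = ℕP.≤-trans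
    (count-mono λ a a∈P → ∈-∩⁺ P (below f n) a∈P (Equivalence.to BoolP.T-≡ (ℕP.<⇒<ᵇ (f<n a a∈P))))
    (count-below-≤ P f n c fibres≤c)

  count-≥-fibres : ∀ P (f : A → ℕ) n c → (∀ j → j < n → c ≤ count (P ∩ fibre f j)) → n ℕ.* c ≤ count P
  count-≥-fibres P f n c c≤fibres = ℕP.≤-trans (count-below-≥ P f n c c≤fibres)
    (count-mono λ a → proj₁ ∘ ∈-∩⁻ P (below f n))

least : (ℕ → Bool) → ℕ → ℕ
least p zero    = zero
least p (suc b) = if p 0 then 0 else suc (least (p ∘ suc) b)

least-holds : ∀ p b {j} → j ≤ b → j ∈ p → least p b ∈ p
least-holds p zero    z≤n       0∈p = 0∈p
least-holds p (suc b) {j} j≤1+b j∈p with p 0 in p0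
... | true  = p0
... | false with j | j≤1+b
...   | zero  | _       = contradiction (trans (sym p0) j∈p) λ ()
...   | suc i | s≤s i≤b = least-holds (p ∘ suc) b i≤b j∈p

least-≤ : ∀ p b {j} → j ≤ b → j ∈ p → least p b ≤ j
least-≤ p zero    z≤n       _   = z≤n
least-≤ p (suc b) {j} j≤1+b j∈p with p 0 in p0
... | true  = z≤n
... | false with j | j≤1+b
...   | zero  | _       = contradiction (trans (sym p0) j∈p) λ ()
...   | suc i | s≤s i≤b = s≤s (least-≤ (p ∘ suc) b i≤b j∈p)

least-minimal : ∀ p b {i} → i < least p b → ¬ i ∈ p
least-minimal p (suc b) {i} i<least i∈p with p 0 in p0
... | true  = contradiction i<least λ ()
... | false with i | i<least
...   | zero  | _           = contradiction (trans (sym p0) i∈p) λ ()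
...   | suc i | s≤s i<least = least-minimal (p ∘ suc) b i<least i∈p

-- Subgroups of a discriminant form, orthogonality and sums of subgroups

module Theory (D : DiscriminantForm) where

  open DiscriminantForm D hiding (_+_; -_; _·ℕ_)

  infixl 6 _+_ _-_
  infix  8 -_
  infixr 7 _·ℕ_

  _·ℕ_ : ℕ → Carrier → Carrier
  _·ℕ_ = DiscriminantForm._·ℕ_ D

  _+_ : Carrier → Carrier → Carrier
  _+_ = DiscriminantForm._+_ D

  -_ : Carrier → Carrier
  -_ = DiscriminantForm.-_ D

  open IsAbelianGroup isAbelianGroup using (assoc; comm; identityˡ; identityʳ; inverseˡ; inverseʳ)
  abelianGroup : AbelianGroup 0ℓ 0ℓ
  abelianGroup = record { isAbelianGroup = isAbelianGroup }

  open import Algebra.Properties.CommutativeSemigroup (AbelianGroup.commutativeSemigroup abelianGroup)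
    using (interchange)
  open import Algebra.Properties.AbelianGroup abelianGroup
    using (//-rightDividesˡ; //-rightDividesʳ; ⁻¹-involutive; ⁻¹-anti-homo-//; ε⁻¹≈ε; inverseʳ-unique)

  Subset : Set
  Subset = Carrier → Bool

  _-_ : Carrier → Carrier → Carrier
  x - y = x + - y

  elements-unique : Unique elements
  elements-unique = UniqueP.map⁺ (Injection.injective (↔⇒↣ enum)) (UniqueP.allFin⁺ size)

  elements-complete : ∀ x → x ∈ₗ elements
  elements-complete x = subst (_∈ₗ elements) (Inverse.strictlyInverseˡ enum x) (∈-map⁺ (Inverse.to enum) (∈-allFin _))

  open FiniteEnumeration elements elements-unique elements-complete public

  x-x≡0 : ∀ x → x - x ≡ 0#
  x-x≡0 = inverseʳ

  x-0≡x : ∀ x → x - 0# ≡ x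
  x-0≡x x = trans (cong (x +_) ε⁻¹≈ε) (identityʳ x)

  [x-y]+y≡x : ∀ x y → (x - y) + y ≡ x
  [x-y]+y≡x x y = //-rightDividesˡ y x

  [x+y]-y≡x : ∀ x y → (x + y) - y ≡ x
  [x+y]-y≡x x y = //-rightDividesʳ y x

  interchange-diff : ∀ x y b c → (x - y) - (b - c) ≡ (x - b) - (y - c)
  interchange-diff x y b c = begin
    (x - y) - (b - c)      ≡⟨ cong ((x - y) +_) (⁻¹-anti-homo-// b c) ⟩
    (x + - y) + (c + - b)  ≡⟨ interchange x (- y) c (- b) ⟩
    (x + c) + (- y + - b)  ≡⟨ cong ((x + c) +_) (comm (- y) (- b)) ⟩
    (x + c) + (- b + - y)  ≡⟨ interchange x (- b) c (- y) ⟨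
    (x + - b) + (c + - y)  ≡⟨ cong ((x - b) +_) (⁻¹-anti-homo-// y c) ⟨
    (x - b) - (y - c)      ∎
    where open ≡-Reasoning

  ·ℕ-+ : ∀ m n y → (m ℕ.+ n) ·ℕ y ≡ m ·ℕ y + n ·ℕ y
  ·ℕ-+ zero    n y = sym (identityˡ _)
  ·ℕ-+ (suc m) n y = trans (cong (y +_) (·ℕ-+ m n y)) (sym (assoc y _ _))

  ·ℕ-* : ∀ m n y → (m ℕ.* n) ·ℕ y ≡ m ·ℕ n ·ℕ y
  ·ℕ-* zero    n y = refl
  ·ℕ-* (suc m) n y = trans (·ℕ-+ n (m ℕ.* n) y) (cong (n ·ℕ y +_) (·ℕ-* m n y))

  ·ℕ-0 : ∀ n → n ·ℕ 0# ≡ 0#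
  ·ℕ-0 zero    = refl
  ·ℕ-0 (suc n) = trans (identityˡ _) (·ℕ-0 n)

  +-cancelʳ : ∀ c {x y} → x + c ≡ y + c → x ≡ y
  +-cancelʳ c {x} {y} e = trans (sym ([x+y]-y≡x x c)) (trans (cong (_- c) e) ([x+y]-y≡x y c))

  infix 4 _≟_
  _≟_ : DecidableEquality Carrier
  _≟_ = inj⇒≟ (↔⇒↣ (↔-sym enum))

  ∈-+ : ∀ {H x y} → IsSubgroup D H → x ∈ H → y ∈ H → x + y ∈ H
  ∈-+ (_ , +-closed , _) = +-closed _ _

  ∈-neg : ∀ {H x} → IsSubgroup D H → x ∈ H → - x ∈ H
  ∈-neg (_ , _ , neg-closed) = neg-closed _

  ∈-diff : ∀ {H x y} → IsSubgroup D H → x ∈ H → y ∈ H → x - y ∈ H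
  ∈-diff H-sub x∈H y∈H = ∈-+ H-sub x∈H (∈-neg H-sub y∈H)

  ∈-·ℕ : ∀ {H} → IsSubgroup D H → ∀ n {y} → y ∈ H → n ·ℕ y ∈ H
  ∈-·ℕ H-sub zero    _   = proj₁ H-sub
  ∈-·ℕ H-sub (suc n) y∈H = ∈-+ H-sub y∈H (∈-·ℕ H-sub n y∈H)

  IsSubgroup-by-diff : ∀ {H} → 0# ∈ H → (∀ {x y} → x ∈ H → y ∈ H → x - y ∈ H) → IsSubgroup D H
  IsSubgroup-by-diff {H} 0∈H diff-closed = 0∈H , +-closed , (λ _ → neg-closed)
    where
    neg-closed : ∀ {y} → y ∈ H → - y ∈ H
    neg-closed y∈H = subst (_∈ H) (identityˡ _) (diff-closed 0∈H y∈H)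

    +-closed : ∀ x y → x ∈ H → y ∈ H → x + y ∈ H
    +-closed x y x∈H y∈H = subst (_∈ H) (cong (x +_) (⁻¹-involutive y)) (diff-closed x∈H (neg-closed y∈H))

  ∩-subgroup : ∀ {A B} → IsSubgroup D A → IsSubgroup D B → IsSubgroup D (A ∩ B)
  ∩-subgroup {A} {B} A-sub B-sub = IsSubgroup-by-diff (∈-∩⁺ A B (proj₁ A-sub) (proj₁ B-sub)) λ x∈ y∈ →
    let (x∈A , x∈B) = ∈-∩⁻ A B x∈ ; (y∈A , y∈B) = ∈-∩⁻ A B y∈
    in ∈-∩⁺ A B (∈-diff A-sub x∈A y∈A) (∈-diff B-sub x∈B y∈B)

  full : Subset
  full _ = true

  trivial : Subset
  trivial = ⌊ _≟ 0# ⌋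

  full-subgroup : IsSubgroup D full
  full-subgroup = refl , (λ _ _ _ _ → refl) , λ _ _ → refl

  trivial-subgroup : IsSubgroup D trivial
  trivial-subgroup = IsSubgroup-by-diff (∈⌊⌋⁺ (_≟ 0#) refl) λ x∈ y∈ →
    ∈⌊⌋⁺ (_≟ 0#) (subst₂ (λ x y → x - y ≡ 0#) (sym (∈⌊⌋⁻ (_≟ 0#) x∈)) (sym (∈⌊⌋⁻ (_≟ 0#) y∈)) (x-x≡0 0#))

  count-≤-differences : ∀ {P R} → (∀ {a r} → a ∈ P → r ∈ P → a - r ∈ R) → count P ≤ count R
  count-≤-differences {P} {R} diff with ∃? (_∈? P)
  ... | yes (r , r∈P) = count-inj (_- r) (+-cancelʳ (- r)) λ a a∈P → diff a∈P r∈P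
  ... | no  P-empty   = ℕP.≤-trans (count-≤-length {ys = []} λ a a∈P → contradiction (a , a∈P) P-empty) z≤n

  infix 4 _⊥_
  _⊥_ : Carrier → Carrier → Set
  x ⊥ y = IsInt (B x y)

  B-sym : ∀ x y → B x y ≡ B y x
  B-sym x y = trans (cong (λ z → Q z ℚ.- Q x ℚ.- Q y) (comm x y))
                    (solve 3 (λ a b c → a :- b :- c := a :- c :- b) refl (Q (y + x)) (Q x) (Q y))

  ⊥-sym : ∀ {x y} → x ⊥ y → y ⊥ x
  ⊥-sym {x} {y} = IsInt-resp (B-sym x y)

  B-diffˡ : ∀ x x' y → B (x - x') y ≡ℚ/ℤ (B x y ℚ.- B x' y)
  B-diffˡ x x' y = IsInt-resp (solve 3 (λ b d b' → :- (b :- (d :+ b')) := d :- (b :- b')) refl (B x y) (B (x - x') y) (B x' y))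
    (IsInt-neg (subst (λ z → B z y ≡ℚ/ℤ (B (x - x') y ℚ.+ B x' y)) ([x-y]+y≡x x x') (B-bilinear (x - x') x' y)))

  ⊥-0ˡ : ∀ y → 0# ⊥ y
  ⊥-0ˡ y = ≡ℚ/ℤ-IsInt {B 0# y} (subst (λ z → B z y ≡ℚ/ℤ (B 0# y ℚ.- B 0# y)) (x-x≡0 0#) (B-diffˡ 0# 0# y))
                      (IsInt-resp (sym (ℚP.+-inverseʳ (B 0# y))) (IsInt-ℤ (ℤ.+ 0)))

  ⊥-+ˡ : ∀ {x x' y} → x ⊥ y → x' ⊥ y → x + x' ⊥ y
  ⊥-+ˡ {x} {x'} {y} x⊥y x'⊥y = ≡ℚ/ℤ-IsInt {B (x + x') y} (B-bilinear x x' y) (IsInt-+ x⊥y x'⊥y)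

  ⊥-diffˡ : ∀ {x x' y} → x ⊥ y → x' ⊥ y → x - x' ⊥ y
  ⊥-diffˡ {x} {x'} {y} x⊥y x'⊥y = ≡ℚ/ℤ-IsInt {B (x - x') y} (B-diffˡ x x' y) (IsInt-diff x⊥y x'⊥y)

  B-·ℕˡ : ∀ n x y → B (n ·ℕ x) y ≡ℚ/ℤ (ℤtoℚ (ℤ.+ n) ℚ.* B x y)
  B-·ℕˡ zero    x y = IsInt-diff {B 0# y} (⊥-0ˡ y) (IsInt-resp (sym (ℚP.*-zeroˡ (B x y))) (IsInt-ℤ (ℤ.+ 0)))
  B-·ℕˡ (suc n) x y = ≡ℚ/ℤ-trans {B (suc n ·ℕ x) y} {b ℚ.+ B (n ·ℕ x) y} {ℤtoℚ (ℤ.+ suc n) ℚ.* b}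
    (B-bilinear x (n ·ℕ x) y)
    (subst ((b ℚ.+ B (n ·ℕ x) y) ≡ℚ/ℤ_) (sym [1+n]b≡b+nb) (≡ℚ/ℤ-+ˡ b {B (n ·ℕ x) y} {nb} (B-·ℕˡ n x y)))
    where
    b = B x y
    nb = ℤtoℚ (ℤ.+ n) ℚ.* b
    [1+n]b≡b+nb : ℤtoℚ (ℤ.+ suc n) ℚ.* b ≡ b ℚ.+ nb
    [1+n]b≡b+nb = trans (cong (ℚ._* b) (ℤtoℚ-+ (ℤ.+ 1) (ℤ.+ n)))
                 (trans (ℚP.*-distribʳ-+ b ℚ.1ℚ (ℤtoℚ (ℤ.+ n))) (cong (ℚ._+ nb) (ℚP.*-identityˡ b)))

  ⊥-·ℕˡ : ∀ n {x y} → x ⊥ y → n ·ℕ x ⊥ y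
  ⊥-·ℕˡ n {x} {y} x⊥y = ≡ℚ/ℤ-IsInt {B (n ·ℕ x) y} (B-·ℕˡ n x y) (IsInt-* (IsInt-ℤ (ℤ.+ n)) x⊥y)

  InPerp? : ∀ Y → Decidable (InPerp D Y)
  InPerp? Y x = ∀? λ β → (β ∈? Y) →-dec isInt? (B x β)

  infix 25 _ᗮ
  _ᗮ : Subset → Subset
  Y ᗮ = ⌊ InPerp? Y ⌋

  ∈ᗮ⁺ : ∀ {Y x} → InPerp D Y x → x ∈ Y ᗮ
  ∈ᗮ⁺ {Y} = ∈⌊⌋⁺ (InPerp? Y)

  ∈ᗮ⁻ : ∀ {Y x} → x ∈ Y ᗮ → InPerp D Y x
  ∈ᗮ⁻ {Y} = ∈⌊⌋⁻ (InPerp? Y)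

  ᗮ-subgroup : ∀ Y → IsSubgroup D (Y ᗮ)
  ᗮ-subgroup Y = IsSubgroup-by-diff (∈ᗮ⁺ λ β _ → ⊥-0ˡ β) λ x∈ y∈ →
    ∈ᗮ⁺ λ β β∈Y → ⊥-diffˡ (∈ᗮ⁻ x∈ β β∈Y) (∈ᗮ⁻ y∈ β β∈Y)

  ⊆ᗮᗮ : ∀ Y → Y ⊆ Y ᗮ ᗮ
  ⊆ᗮᗮ Y x x∈Y = ∈ᗮ⁺ λ β β∈Yᗮ → ⊥-sym (∈ᗮ⁻ β∈Yᗮ x x∈Y)

  ᗮ-antitone : ∀ {A B} → A ⊆ B → B ᗮ ⊆ A ᗮ
  ᗮ-antitone A⊆B x x∈Bᗮ = ∈ᗮ⁺ λ β β∈A → ∈ᗮ⁻ x∈Bᗮ β (A⊆B β β∈A)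

  infixl 6 _⊕_
  _⊕_ : Subset → Subset → Subset
  A ⊕ B = ⌊ (λ x → ∃? λ b → b ∈? B ×-dec x - b ∈? A) ⌋

  ∈⊕⁺ : ∀ A B {x} b → b ∈ B → x - b ∈ A → x ∈ A ⊕ B
  ∈⊕⁺ A B b b∈B x-b∈A = ∈⌊⌋⁺ (λ x → ∃? λ b → b ∈? B ×-dec x - b ∈? A) (b , b∈B , x-b∈A)

  ∈⊕⁻ : ∀ A B {x} → x ∈ A ⊕ B → ∃[ b ] b ∈ B × x - b ∈ A
  ∈⊕⁻ A B = ∈⌊⌋⁻ (λ x → ∃? λ b → b ∈? B ×-dec x - b ∈? A)

  ⊆⊕ˡ : ∀ A B → IsSubgroup D B → A ⊆ A ⊕ B
  ⊆⊕ˡ A B B-sub x x∈A = ∈⊕⁺ A B 0# (proj₁ B-sub) (subst (_∈ A) (sym (x-0≡x x)) x∈A)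

  ⊆⊕ʳ : ∀ A B → IsSubgroup D A → B ⊆ A ⊕ B
  ⊆⊕ʳ A B A-sub x x∈B = ∈⊕⁺ A B x x∈B (subst (_∈ A) (sym (x-x≡0 x)) (proj₁ A-sub))

  ⊕-least : ∀ {A B C} → IsSubgroup D C → A ⊆ C → B ⊆ C → A ⊕ B ⊆ C
  ⊕-least {A} {B} {C} C-sub A⊆C B⊆C x x∈A⊕B with b , b∈B , x-b∈A ← ∈⊕⁻ A B x∈A⊕B =
    subst (_∈ C) ([x-y]+y≡x x b) (∈-+ C-sub (A⊆C _ x-b∈A) (B⊆C b b∈B))

  ⊕-subgroup : ∀ {A B} → IsSubgroup D A → IsSubgroup D B → IsSubgroup D (A ⊕ B)
  ⊕-subgroup {A} {B} A-sub B-sub = IsSubgroup-by-diff (⊆⊕ʳ A B A-sub 0# (proj₁ B-sub)) diff-closed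
    where
    diff-closed : ∀ {x y} → x ∈ A ⊕ B → y ∈ A ⊕ B → x - y ∈ A ⊕ B
    diff-closed {x} {y} x∈ y∈ with b , b∈B , x-b∈A ← ∈⊕⁻ A B x∈ | c , c∈B , y-c∈A ← ∈⊕⁻ A B y∈ =
      ∈⊕⁺ A B (b - c) (∈-diff B-sub b∈B c∈B) (subst (_∈ A) (sym (interchange-diff x y b c)) (∈-diff A-sub x-b∈A y-c∈A))

  InPerp-⊕ : ∀ {A B x} → InPerp D A x → InPerp D B x → InPerp D (A ⊕ B) x
  InPerp-⊕ {A} {B} {x} x⊥A x⊥B y y∈A⊕B with b , b∈B , y-b∈A ← ∈⊕⁻ A B y∈A⊕B =
    ⊥-sym (subst (_⊥ x) ([x-y]+y≡x y b) (⊥-+ˡ (⊥-sym (x⊥A _ y-b∈A)) (⊥-sym (x⊥B b b∈B))))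

  Q-integral-+ : ∀ {x y} → IsInt (Q x) → IsInt (Q y) → x ⊥ y → IsInt (Q (x + y))
  Q-integral-+ {x} {y} Qx Qy x⊥y = IsInt-resp
    (solve 3 (λ a b c → (a :- b :- c) :+ b :+ c := a) refl (Q (x + y)) (Q x) (Q y)) (IsInt-+ (IsInt-+ x⊥y Qx) Qy)

  Q-integral-⊕ : ∀ {A B} → (∀ a → a ∈ A → IsInt (Q a)) → (∀ b → b ∈ B → IsInt (Q b)) → A ⊆ B ᗮ
               → ∀ x → x ∈ A ⊕ B → IsInt (Q x)
  Q-integral-⊕ {A} {B} QA QB A⊆Bᗮ x x∈A⊕B with b , b∈B , x-b∈A ← ∈⊕⁻ A B x∈A⊕B =
    subst (IsInt ∘ Q) ([x-y]+y≡x x b) (Q-integral-+ (QA _ x-b∈A) (QB b b∈B) (∈ᗮ⁻ (A⊆Bᗮ _ x-b∈A) b b∈B))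

  selfDualIsotropic⇒maximal : ∀ H → IsSelfDualIsotropic D H → IsMaximalIsotropic D H
  selfDualIsotropic⇒maximal H (H-selfDual , H-iso) = H-iso , λ K (_ , K-orth , _) H⊆K γ γ∈K →
    proj₂ (H-selfDual γ) λ β β∈H → K-orth γ γ∈K β (H⊆K β β∈H)

  maximal⇒selfDualIsotropic : (∀ H → IsIsotropic D H → ∃[ T ] IsSelfDualIsotropic D T × H ⊆ T)
                            → ∀ H → IsMaximalIsotropic D H → IsSelfDualIsotropic D H
  maximal⇒selfDualIsotropic extend H (H-iso , H-maximal) with T , (T-selfDual , T-iso) , H⊆T ← extend H H-iso =
    (λ γ → proj₁ (proj₂ H-iso) γ , λ γ⊥H → T⊆H γ (proj₂ (T-selfDual γ) λ β β∈T → γ⊥H β (T⊆H β β∈T))) , H-iso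
    where
    T⊆H : T ⊆ H
    T⊆H = H-maximal T T-iso H⊆T

  -- |Y| |Yᗮ| = |D|, and Yᗮᗮ = Y

  level⇒exponent : ∀ {N} → IsLevel D N → ∀ y → N ·ℕ y ≡ 0#
  level⇒exponent {N} (_ , NQ-integral , _) y = nondegenerate (N ·ℕ y) λ γ →
    ≡ℚ/ℤ-IsInt {B (N ·ℕ y) γ} (B-·ℕˡ N y γ)
      (IsInt-resp (solve 4 (λ n a b c → n :* a :- n :* b :- n :* c := n :* (a :- b :- c)) refl (ℤtoℚ (ℤ.+ N)) (Q (y + γ)) (Q y) (Q γ))
        (IsInt-diff (IsInt-diff (NQ-integral (y + γ)) (NQ-integral y)) (NQ-integral γ)))

  exponent-of-level : ∀ {N} → IsLevel D N → ∃[ N' ] ∀ y → suc N' ·ℕ y ≡ 0#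
  exponent-of-level {zero}   (record { nonZero = () } , _)
  exponent-of-level {suc N'} level = N' , level⇒exponent level

  IsOrderModulo : Subset → Carrier → ℕ → Set
  IsOrderModulo Z y n = n ·ℕ y ∈ Z × (∀ j → 0 < j → j < n → ¬ j ·ℕ y ∈ Z)

  module WithExponent (N' : ℕ) (exponent : ∀ y → suc N' ·ℕ y ≡ 0#) where

    N : ℕ
    N = suc N'

    [m*N]·ℕ≡0 : ∀ m y → (m ℕ.* N) ·ℕ y ≡ 0#
    [m*N]·ℕ≡0 m y = trans (·ℕ-* m N y) (trans (cong (m ·ℕ_) (exponent y)) (·ℕ-0 m))

    ·ℕ-%N : ∀ j y → j ·ℕ y ≡ (j % N) ·ℕ y
    ·ℕ-%N j y = begin
      j ·ℕ y                              ≡⟨ cong (_·ℕ y) (m≡m%n+[m/n]*n j N) ⟩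
      (j % N ℕ.+ j / N ℕ.* N) ·ℕ y       ≡⟨ ·ℕ-+ (j % N) _ y ⟩
      (j % N) ·ℕ y + (j / N ℕ.* N) ·ℕ y  ≡⟨ cong ((j % N) ·ℕ y +_) ([m*N]·ℕ≡0 (j / N) y) ⟩
      (j % N) ·ℕ y + 0#                   ≡⟨ identityʳ _ ⟩
      (j % N) ·ℕ y                        ∎
      where open ≡-Reasoning

    neg-·ℕ : ∀ j y → - (j ·ℕ y) ≡ (N' ℕ.* j) ·ℕ y
    neg-·ℕ j y = sym (inverseʳ-unique (j ·ℕ y) _ (begin
      j ·ℕ y + (N' ℕ.* j) ·ℕ y   ≡⟨ ·ℕ-+ j (N' ℕ.* j) y ⟨
      (N ℕ.* j) ·ℕ y             ≡⟨ cong (_·ℕ y) (ℕP.*-comm N j) ⟩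
      (j ℕ.* N) ·ℕ y             ≡⟨ [m*N]·ℕ≡0 j y ⟩
      0#                         ∎))
      where open ≡-Reasoning

    ⟨_⟩ : Carrier → Subset
    ⟨ y ⟩ = ⌊ (λ x → anyUpTo? (λ j → j ·ℕ y ≟ x) N) ⌋

    ∈⟨⟩⁺ : ∀ j y → j ·ℕ y ∈ ⟨ y ⟩
    ∈⟨⟩⁺ j y = ∈⌊⌋⁺ (λ x → anyUpTo? (λ j → j ·ℕ y ≟ x) N) (j % N , m%n<n j N , sym (·ℕ-%N j y))

    ∈⟨⟩⁻ : ∀ {x y} → x ∈ ⟨ y ⟩ → ∃[ j ] j ·ℕ y ≡ x
    ∈⟨⟩⁻ {y = y} x∈⟨y⟩ with j , _ , jy≡x ← ∈⌊⌋⁻ (λ x → anyUpTo? (λ j → j ·ℕ y ≟ x) N) x∈⟨y⟩ = j , jy≡x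

    ⟨⟩-subgroup : ∀ y → IsSubgroup D ⟨ y ⟩
    ⟨⟩-subgroup y = IsSubgroup-by-diff (∈⟨⟩⁺ 0 y) λ x∈ x'∈ → diff-closed (∈⟨⟩⁻ x∈) (∈⟨⟩⁻ x'∈)
      where
      diff-closed : ∀ {x x'} → ∃[ i ] i ·ℕ y ≡ x → ∃[ j ] j ·ℕ y ≡ x' → x - x' ∈ ⟨ y ⟩
      diff-closed (i , refl) (j , refl) =
        subst (_∈ ⟨ y ⟩) (trans (·ℕ-+ i (N' ℕ.* j) y) (cong (i ·ℕ y +_) (sym (neg-·ℕ j y)))) (∈⟨⟩⁺ (i ℕ.+ N' ℕ.* j) y)

    ⟨⟩-least : ∀ {C y} → IsSubgroup D C → y ∈ C → ⟨ y ⟩ ⊆ C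
    ⟨⟩-least {C} C-sub y∈C x x∈⟨y⟩ with j , refl ← ∈⟨⟩⁻ x∈⟨y⟩ = ∈-·ℕ C-sub j y∈C

    InPerp-⟨⟩ : ∀ {x y} → x ⊥ y → InPerp D ⟨ y ⟩ x
    InPerp-⟨⟩ x⊥y z z∈⟨y⟩ with j , refl ← ∈⟨⟩⁻ z∈⟨y⟩ = ⊥-sym (⊥-·ℕˡ j (⊥-sym x⊥y))

    order-modulo : ∀ {Z} → IsSubgroup D Z → ∀ y → ∃[ k ] IsOrderModulo Z y (suc k)
    order-modulo {Z} Z-sub y = k , least-holds p N' ℕP.≤-refl N'∈p , λ { (suc i) _ (s≤s i<k) → least-minimal p N' i<k }
      where
      p : ℕ → Bool
      p j = Z (suc j ·ℕ y)
      N'∈p : N' ∈ p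
      N'∈p = subst (_∈ Z) (sym (exponent y)) (proj₁ Z-sub)
      k = least p N'

    module Step {Z₀ W : Subset} (Z₀-sub : IsSubgroup D Z₀) (W-sub : IsSubgroup D W)
                (y : Carrier) (k : ℕ) (order : IsOrderModulo Z₀ y (suc k)) where

      n : ℕ
      n = suc k

      Z₁ : Subset
      Z₁ = Z₀ ⊕ ⟨ y ⟩

      Z₁-subgroup : IsSubgroup D Z₁
      Z₁-subgroup = ⊕-subgroup Z₀-sub (⟨⟩-subgroup y)

      Z₀⊆Z₁ : Z₀ ⊆ Z₁
      Z₀⊆Z₁ = ⊆⊕ˡ Z₀ ⟨ y ⟩ (⟨⟩-subgroup y)

      y∈Z₁ : y ∈ Z₁
      y∈Z₁ = ⊆⊕ʳ Z₀ ⟨ y ⟩ Z₀-sub y (subst (_∈ ⟨ y ⟩) (identityʳ y) (∈⟨⟩⁺ 1 y))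

      -- the j < n with x ∈ Z₀ + j y, unique by minimality of n
      coset : Carrier → ℕ
      coset x = least (λ i → Z₀ (x - i ·ℕ y)) n

      coset-translate : ∀ {z j} → z ∈ Z₀ → j < n → coset (z + j ·ℕ y) ≡ j
      coset-translate {z} {j} z∈Z₀ j<n =
        ℕP.≤-antisym (least-≤ p n (ℕP.<⇒≤ j<n) j∈p)
                     (ℕP.≮⇒≥ λ coset<j → not-before _ coset<j (least-holds p n (ℕP.<⇒≤ j<n) j∈p))
        where
        p : ℕ → Bool
        p i = Z₀ ((z + j ·ℕ y) - i ·ℕ y)
        j∈p : j ∈ p
        j∈p = subst (_∈ Z₀) (sym ([x+y]-y≡x z (j ·ℕ y))) z∈Z₀
        not-before : ∀ i → i < j → ¬ i ∈ p
        not-before i i<j i∈p = proj₂ order (j ℕ.∸ i) (ℕP.m<n⇒0<n∸m i<j) (ℕP.≤-<-trans (ℕP.m∸n≤m j i) j<n)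
          (subst (_∈ Z₀) ([x+y]-y≡x _ z) (∈-diff Z₀-sub (subst (_∈ Z₀) (shift i (j ℕ.∸ i)) i∈p') z∈Z₀))
          where
          i∈p' : (z + (i ℕ.+ (j ℕ.∸ i)) ·ℕ y) - i ·ℕ y ∈ Z₀
          i∈p' = subst (λ m → (z + m ·ℕ y) - i ·ℕ y ∈ Z₀) (sym (ℕP.m+[n∸m]≡n (ℕP.<⇒≤ i<j))) i∈p
          shift : ∀ i e → (z + (i ℕ.+ e) ·ℕ y) - i ·ℕ y ≡ e ·ℕ y + z
          shift i e = begin
            (z + (i ℕ.+ e) ·ℕ y) - i ·ℕ y   ≡⟨ cong (λ w → (z + w) - i ·ℕ y) (trans (·ℕ-+ i e y) (comm _ _)) ⟩
            (z + (e ·ℕ y + i ·ℕ y)) - i ·ℕ y ≡⟨ cong (_- i ·ℕ y) (assoc z _ _) ⟨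
            (z + e ·ℕ y + i ·ℕ y) - i ·ℕ y   ≡⟨ [x+y]-y≡x _ _ ⟩
            z + e ·ℕ y                        ≡⟨ comm z _ ⟩
            e ·ℕ y + z                        ∎
            where open ≡-Reasoning

      n*count-Z₀≤count-Z₁ : n ℕ.* count Z₀ ≤ count Z₁
      n*count-Z₀≤count-Z₁ = count-≥-fibres Z₁ coset n (count Z₀) λ j j<n →
        count-inj (_+ j ·ℕ y) (+-cancelʳ (j ·ℕ y)) λ z z∈Z₀ →
          ∈-∩⁺ Z₁ (fibre coset j)
            (∈⊕⁺ Z₀ ⟨ y ⟩ (j ·ℕ y) (∈⟨⟩⁺ j y) (subst (_∈ Z₀) (sym ([x+y]-y≡x z (j ·ℕ y))) z∈Z₀))
            (∈-fibre⁺ {f = coset} (coset-translate z∈Z₀ j<n))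

      -- the class of B(y, a) in (1/n)ℤ/ℤ, read off the integer n B(y, a) for a ∈ Z₀ᗮ
      pairing : Carrier → ℕ
      pairing a = residue n (ℤtoℚ (ℤ.+ n) ℚ.* B y a)

      n·B-integral : ∀ {a} → a ∈ Z₀ ᗮ → IsInt (ℤtoℚ (ℤ.+ n) ℚ.* B y a)
      n·B-integral {a} a∈Z₀ᗮ = ≡ℚ/ℤ-IsInt {ℤtoℚ (ℤ.+ n) ℚ.* B y a} {B (n ·ℕ y) a}
        (≡ℚ/ℤ-sym {B (n ·ℕ y) a} (B-·ℕˡ n y a)) (⊥-sym (∈ᗮ⁻ a∈Z₀ᗮ (n ·ℕ y) (proj₁ order)))

      same-pairing⇒⊥ : ∀ {a r} → a ∈ Z₀ ᗮ → r ∈ Z₀ ᗮ → pairing a ≡ pairing r → a - r ⊥ y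
      same-pairing⇒⊥ {a} {r} a∈Z₀ᗮ r∈Z₀ᗮ same = ≡ℚ/ℤ-IsInt {B (a - r) y} (B-diffˡ a r y)
        (subst₂ (λ u v → IsInt (u ℚ.- v)) (B-sym y a) (B-sym y r)
          (same-residue⇒≡ℚ/ℤ k (n·B-integral a∈Z₀ᗮ) (n·B-integral r∈Z₀ᗮ) same))

      count-W∩Z₀ᗮ≤ : count (W ∩ Z₀ ᗮ) ≤ n ℕ.* count (W ∩ Z₁ ᗮ)
      count-W∩Z₀ᗮ≤ = count-≤-fibres (W ∩ Z₀ ᗮ) pairing n _ (λ a _ → residue<n n (ℤtoℚ (ℤ.+ n) ℚ.* B y a))
                                    λ j _ → count-≤-differences (difference-in-W∩Z₁ᗮ j)
        where
        difference-in-W∩Z₁ᗮ : ∀ j {a r} → a ∈ (W ∩ Z₀ ᗮ) ∩ fibre pairing j → r ∈ (W ∩ Z₀ ᗮ) ∩ fibre pairing j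
                            → a - r ∈ W ∩ Z₁ ᗮ
        difference-in-W∩Z₁ᗮ j a∈ r∈ =
          let (a∈W∩Z₀ᗮ , a∈fibre) = ∈-∩⁻ (W ∩ Z₀ ᗮ) (fibre pairing j) a∈
              (r∈W∩Z₀ᗮ , r∈fibre) = ∈-∩⁻ (W ∩ Z₀ ᗮ) (fibre pairing j) r∈
              (a∈W , a∈Z₀ᗮ) = ∈-∩⁻ W (Z₀ ᗮ) a∈W∩Z₀ᗮ
              (r∈W , r∈Z₀ᗮ) = ∈-∩⁻ W (Z₀ ᗮ) r∈W∩Z₀ᗮ
              a-r⊥y = same-pairing⇒⊥ a∈Z₀ᗮ r∈Z₀ᗮ
                        (trans (∈-fibre⁻ {f = pairing} a∈fibre) (sym (∈-fibre⁻ {f = pairing} r∈fibre)))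
          in ∈-∩⁺ W (Z₁ ᗮ) (∈-diff W-sub a∈W r∈W)
               (∈ᗮ⁺ (InPerp-⊕ (∈ᗮ⁻ (∈-diff (ᗮ-subgroup Z₀) a∈Z₀ᗮ r∈Z₀ᗮ)) (InPerp-⟨⟩ a-r⊥y)))

      count-step : count Z₀ ℕ.* count (W ∩ Z₀ ᗮ) ≤ count Z₁ ℕ.* count (W ∩ Z₁ ᗮ)
      count-step = begin
        c₀ ℕ.* count (W ∩ Z₀ ᗮ)  ≤⟨ ℕP.*-monoʳ-≤ c₀ count-W∩Z₀ᗮ≤ ⟩
        c₀ ℕ.* (n ℕ.* w₁)        ≡⟨ ℕP.*-assoc c₀ n w₁ ⟨
        c₀ ℕ.* n ℕ.* w₁          ≡⟨ cong (ℕ._* w₁) (ℕP.*-comm c₀ n) ⟩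
        n ℕ.* c₀ ℕ.* w₁          ≤⟨ ℕP.*-monoˡ-≤ w₁ n*count-Z₀≤count-Z₁ ⟩
        count Z₁ ℕ.* w₁          ∎
        where
        open ℕP.≤-Reasoning
        c₀ = count Z₀
        w₁ = count (W ∩ Z₁ ᗮ)

    count-chain : ∀ {W Z₀ Z} → IsSubgroup D W → IsSubgroup D Z₀ → IsSubgroup D Z → Z₀ ⊆ Z
                → count Z₀ ℕ.* count (W ∩ Z₀ ᗮ) ≤ count Z ℕ.* count (W ∩ Z ᗮ)
    count-chain {W} {Z = Z} W-sub Z₀-sub Z-sub Z₀⊆Z = climb (count Z) Z₀-sub Z₀⊆Z (ℕP.m≤m+n (count Z) _)
      where
      -- d bounds |Z| - |Z₀|, and every step strictly enlarges Z₀ inside Z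
      climb : ∀ d {Z₀} → IsSubgroup D Z₀ → Z₀ ⊆ Z → count Z ≤ d ℕ.+ count Z₀
            → count Z₀ ℕ.* count (W ∩ Z₀ ᗮ) ≤ count Z ℕ.* count (W ∩ Z ᗮ)
      climb d {Z₀} Z₀-sub Z₀⊆Z |Z|≤d+|Z₀| with ∃? (λ y → y ∈? Z ×-dec ¬? (y ∈? Z₀))
      ... | no ∄y = ℕP.*-mono-≤ (count-mono Z₀⊆Z) (count-mono λ a a∈ →
            let (a∈W , a∈Z₀ᗮ) = ∈-∩⁻ W (Z₀ ᗮ) a∈ in ∈-∩⁺ W (Z ᗮ) a∈W (ᗮ-antitone Z⊆Z₀ a a∈Z₀ᗮ))
        where
        Z⊆Z₀ : Z ⊆ Z₀
        Z⊆Z₀ y y∈Z with y ∈? Z₀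
        ... | yes y∈Z₀ = y∈Z₀
        ... | no  y∉Z₀ = contradiction (y , y∈Z , y∉Z₀) ∄y
      ... | yes (y , y∈Z , y∉Z₀) with k , order ← order-modulo Z₀-sub y = ℕP.≤-trans count-step (climb-from-Z₁ d |Z|≤d+|Z₀|)
        where
        open Step Z₀-sub W-sub y k order
        Z₁⊆Z : Z₁ ⊆ Z
        Z₁⊆Z = ⊕-least Z-sub Z₀⊆Z (⟨⟩-least Z-sub y∈Z)
        |Z₀|<|Z₁| : count Z₀ < count Z₁
        |Z₀|<|Z₁| = count-mono-< Z₀⊆Z₁ y∈Z₁ y∉Z₀
        climb-from-Z₁ : ∀ d → count Z ≤ d ℕ.+ count Z₀ → count Z₁ ℕ.* count (W ∩ Z₁ ᗮ) ≤ count Z ℕ.* count (W ∩ Z ᗮ)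
        climb-from-Z₁ zero    |Z|≤|Z₀| = contradiction (ℕP.<-≤-trans |Z₀|<|Z₁| (count-mono Z₁⊆Z)) (ℕP.≤⇒≯ |Z|≤|Z₀|)
        climb-from-Z₁ (suc d) |Z|≤1+d+|Z₀| = climb d Z₁-subgroup Z₁⊆Z
          (ℕP.≤-trans |Z|≤1+d+|Z₀| (subst (_≤ d ℕ.+ count Z₁) (ℕP.+-suc d _) (ℕP.+-monoʳ-≤ d |Z₀|<|Z₁|)))

    count-trivial : count trivial ≡ 1
    count-trivial = ℕP.≤-antisym (count-≤-length {ys = 0# ∷ []} λ a a∈ → here (∈⌊⌋⁻ (_≟ 0#) a∈))
                                 (count-pos (∈⌊⌋⁺ (_≟ 0#) refl))

    count-full≤count*countᗮ : ∀ {Y} → IsSubgroup D Y → count full ≤ count Y ℕ.* count (Y ᗮ)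
    count-full≤count*countᗮ {Y} Y-sub = begin
      count full                                 ≤⟨ count-mono full⊆trivialᗮ ⟩
      count (trivial ᗮ)                          ≡⟨ ℕP.*-identityˡ _ ⟨
      1 ℕ.* count (trivial ᗮ)                    ≡⟨ cong (ℕ._* count (trivial ᗮ)) count-trivial ⟨
      count trivial ℕ.* count (full ∩ trivial ᗮ) ≤⟨ count-chain full-subgroup trivial-subgroup Y-sub trivial⊆Y ⟩
      count Y ℕ.* count (Y ᗮ)                    ∎
      where
      open ℕP.≤-Reasoning
      full⊆trivialᗮ : full ⊆ trivial ᗮ
      full⊆trivialᗮ a _ = ∈ᗮ⁺ λ β β∈ → subst (a ⊥_) (sym (∈⌊⌋⁻ (_≟ 0#) β∈)) (⊥-sym (⊥-0ˡ a))
      trivial⊆Y : trivial ⊆ Y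
      trivial⊆Y a a∈ = subst (_∈ Y) (sym (∈⌊⌋⁻ (_≟ 0#) a∈)) (proj₁ Y-sub)

    countᗮ*count≤count-full : ∀ {Y} → IsSubgroup D Y → count (Y ᗮ) ℕ.* count Y ≤ count full
    countᗮ*count≤count-full {Y} Y-sub = begin
      count (Y ᗮ) ℕ.* count Y                  ≤⟨ ℕP.*-monoʳ-≤ (count (Y ᗮ)) (count-mono Y⊆Y∩Yᗮᗮ) ⟩
      count (Y ᗮ) ℕ.* count (Y ∩ Y ᗮ ᗮ)         ≤⟨ count-chain Y-sub (ᗮ-subgroup Y) full-subgroup (λ _ _ → refl) ⟩
      count full ℕ.* count (Y ∩ full ᗮ)          ≤⟨ ℕP.*-monoʳ-≤ (count full) (count-≤-length radical-trivial) ⟩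
      count full ℕ.* 1                           ≡⟨ ℕP.*-identityʳ _ ⟩
      count full                                 ∎
      where
      open ℕP.≤-Reasoning
      Y⊆Y∩Yᗮᗮ : Y ⊆ Y ∩ Y ᗮ ᗮ
      Y⊆Y∩Yᗮᗮ a a∈Y = ∈-∩⁺ Y (Y ᗮ ᗮ) a∈Y (⊆ᗮᗮ Y a a∈Y)
      radical-trivial : ∀ a → a ∈ Y ∩ full ᗮ → a ∈ₗ 0# ∷ []
      radical-trivial a a∈ = here (nondegenerate a λ γ → ∈ᗮ⁻ (proj₂ (∈-∩⁻ Y (full ᗮ) a∈)) γ refl)

    ᗮᗮ⊆ : ∀ {Y} → IsSubgroup D Y → Y ᗮ ᗮ ⊆ Y
    ᗮᗮ⊆ {Y} Y-sub x x∈Yᗮᗮ with x ∈? Y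
    ... | yes x∈Y = x∈Y
    ... | no  x∉Y = contradiction (ℕP.*-cancelʳ-≤ _ _ (count (Y ᗮ)) {{ℕ.>-nonZero |Yᗮ|>0}} |Yᗮᗮ||Yᗮ|≤|Y||Yᗮ|)
                                  (ℕP.<⇒≱ (count-mono-< (⊆ᗮᗮ Y) x∈Yᗮᗮ x∉Y))
      where
      |Yᗮ|>0 : 0 < count (Y ᗮ)
      |Yᗮ|>0 = count-pos (proj₁ (ᗮ-subgroup Y))
      |Yᗮᗮ||Yᗮ|≤|Y||Yᗮ| : count (Y ᗮ ᗮ) ℕ.* count (Y ᗮ) ≤ count Y ℕ.* count (Y ᗮ)
      |Yᗮᗮ||Yᗮ|≤|Y||Yᗮ| = ℕP.≤-trans (countᗮ*count≤count-full (ᗮ-subgroup Y)) (count-full≤count*countᗮ Y-sub)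

    -- Extending an isotropic subgroup to a self-dual one

    module SelfDualExtension {S H} (S-sdi : IsSelfDualIsotropic D S) (H-iso : IsIsotropic D H) where

      T : Subset
      T = (S ∩ H ᗮ) ⊕ H

      private
        S-selfDual = proj₁ S-sdi
        S-iso      = proj₂ S-sdi
        S-sub      = proj₁ S-iso
        H-sub      = proj₁ H-iso
        H⊆Hᗮ : H ⊆ H ᗮ
        H⊆Hᗮ h h∈H = ∈ᗮ⁺ (proj₁ (proj₂ H-iso) h h∈H)

      H⊆T : H ⊆ T
      H⊆T = ⊆⊕ʳ (S ∩ H ᗮ) H (∩-subgroup S-sub (ᗮ-subgroup H))

      T-isotropic : IsIsotropic D T
      T-isotropic = T-sub , (λ γ γ∈T → ∈ᗮ⁻ (T⊆Tᗮ γ γ∈T)) , Q-integral-⊕ QS∩Hᗮ (proj₂ (proj₂ H-iso)) S∩Hᗮ⊆Hᗮ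
        where
        T-sub = ⊕-subgroup (∩-subgroup S-sub (ᗮ-subgroup H)) H-sub
        S∩Hᗮ⊆Hᗮ : S ∩ H ᗮ ⊆ H ᗮ
        S∩Hᗮ⊆Hᗮ a = proj₂ ∘ ∈-∩⁻ S (H ᗮ)
        QS∩Hᗮ : ∀ a → a ∈ S ∩ H ᗮ → IsInt (Q a)
        QS∩Hᗮ a = proj₂ (proj₂ S-iso) a ∘ proj₁ ∘ ∈-∩⁻ S (H ᗮ)
        S∩Hᗮ⊆Tᗮ : S ∩ H ᗮ ⊆ T ᗮ
        S∩Hᗮ⊆Tᗮ a a∈ = let (a∈S , a∈Hᗮ) = ∈-∩⁻ S (H ᗮ) a∈ in ∈ᗮ⁺ (InPerp-⊕
          (λ b b∈ → proj₁ (proj₂ S-iso) a a∈S b (proj₁ (∈-∩⁻ S (H ᗮ) b∈))) (∈ᗮ⁻ a∈Hᗮ))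
        H⊆Tᗮ : H ⊆ T ᗮ
        H⊆Tᗮ h h∈H = ∈ᗮ⁺ (InPerp-⊕ (λ b b∈ → ⊥-sym (∈ᗮ⁻ (S∩Hᗮ⊆Hᗮ b b∈) h h∈H)) (∈ᗮ⁻ (H⊆Hᗮ h h∈H)))
        T⊆Tᗮ : T ⊆ T ᗮ
        T⊆Tᗮ = ⊕-least (ᗮ-subgroup T) S∩Hᗮ⊆Tᗮ H⊆Tᗮ

      T-selfDual : IsSelfDual D T
      T-selfDual γ = proj₁ (proj₂ T-isotropic) γ , Tᗮ⊆T
        where
        Tᗮ⊆T : InPerp D T γ → γ ∈ T
        Tᗮ⊆T γ⊥T = shift-into-S∩Hᗮ (∈⊕⁻ S H (ᗮᗮ⊆ (⊕-subgroup S-sub H-sub) γ γ∈[S⊕H]ᗮᗮ))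
          where
          γ∈Hᗮ : γ ∈ H ᗮ
          γ∈Hᗮ = ∈ᗮ⁺ λ β β∈H → γ⊥T β (H⊆T β β∈H)
          [S⊕H]ᗮ⊆T : (S ⊕ H) ᗮ ⊆ T
          [S⊕H]ᗮ⊆T z z∈ = ⊆⊕ˡ (S ∩ H ᗮ) H H-sub z (∈-∩⁺ S (H ᗮ)
            (proj₂ (S-selfDual z) (∈ᗮ⁻ (ᗮ-antitone (⊆⊕ˡ S H H-sub) z z∈)))
            (ᗮ-antitone (⊆⊕ʳ S H S-sub) z z∈))
          γ∈[S⊕H]ᗮᗮ : γ ∈ (S ⊕ H) ᗮ ᗮ
          γ∈[S⊕H]ᗮᗮ = ∈ᗮ⁺ λ z z∈ → γ⊥T z ([S⊕H]ᗮ⊆T z z∈)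
          shift-into-S∩Hᗮ : ∃[ h ] h ∈ H × γ - h ∈ S → γ ∈ T
          shift-into-S∩Hᗮ (h , h∈H , γ-h∈S) =
            ∈⊕⁺ (S ∩ H ᗮ) H h h∈H (∈-∩⁺ S (H ᗮ) γ-h∈S (∈-diff (ᗮ-subgroup H) γ∈Hᗮ (H⊆Hᗮ h h∈H)))

      T-selfDualIsotropic : IsSelfDualIsotropic D T
      T-selfDualIsotropic = T-selfDual , T-isotropic

open DiscriminantForm using (Carrier; size)
open import Data.Nat using (_*_; _^_)

-- |D| = m² and sign D = 0 are needed only for the existence of S, which is assumed here.
lemma3p8 : (D : DiscriminantForm) (p k m : ℕ)
    → HasPrimePowerLevel D p k
    → size D ≡ m * m
    → SignZero D p k m
    → (∃[ S ] IsSelfDualIsotropic D S)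
    → ((H : Carrier D → Bool) → IsIsotropic D H
         → ∃[ S ] (IsSelfDualIsotropic D S × H ⊆ S))
      × ((H : Carrier D → Bool)
         → (IsMaximalIsotropic D H → IsSelfDualIsotropic D H)
         × (IsSelfDualIsotropic D H → IsMaximalIsotropic D H))
lemma3p8 D p k m (_ , level) _ _ (S , S-sdi) =
  extend , λ H → maximal⇒selfDualIsotropic extend H , selfDualIsotropic⇒maximal H
  where
  open Theory D
  open WithExponent (proj₁ (exponent-of-level level)) (proj₂ (exponent-of-level level))
  extend : ∀ H → IsIsotropic D H → ∃[ T ] IsSelfDualIsotropic D T × H ⊆ T
  extend H H-iso = T , T-selfDualIsotropic , H⊆T
    where open SelfDualExtension S-sdi H-iso
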